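{- Let $G$ be a graph containing no subgraph isomorphic to $C_6$ and let $x\in V(G)$. Then every connected component of $G[N_2(x)]$ all of whose vertices belong to $V(H_x)$ is isomorphic to $K_{1,r}$ for some $r\ge 1$.
   Context: Graphs are finite, simple, undirected. For a nonempty set $S$ of vertices, $N(S)$ (resp. $N[S]$) is the set of vertices at distance exactly $1$ (resp. at most $1$) from $S$; $N_2(x)$ (resp. $N_2[x]$) is the set of vertices at distance exactly $2$ (resp. at most $2$) from $x$; $N[\emptyset]=\emptyset$. "No subgraph isomorphic to $C_6$" refers to not necessarily induced subgraphs. Let $A^*$ be the set of all connected components $A$ of $G[N_2(x)]$ for which there exists a vertex $a\in V(A)$ with $N(x)\cap N(a)=N(x)\cap N(V(A))$, let $V(A^*)$ be the union of the vertex sets of the components in $A^*$, and let $H_x=G[N_2[x]\setminus N[V(A^*)]]$. -}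

module Defs where

open import Data.Nat using (ℕ; zero; suc; _≤_)
open import Data.Fin using (Fin; zero; suc)
open import Data.Bool using (Bool; true; false)
open import Data.Product using (Σ; ∃; _×_; _,_)
open import Data.Sum using (_⊎_)
open import Relation.Nullary using (¬_)
open import Relation.Binary.PropositionalEquality using (_≡_; _≢_)
open import Function.Bundles using (_⇔_)
open import Function.Definitions using (Injective)

record Graph (n : ℕ) : Set where
  field
    adj    : Fin n → Fin n → Bool
    sym    : ∀ u v → adj u v ≡ adj v u
    irrefl : ∀ v → adj v v ≡ false

module _ {n : ℕ} (G : Graph n) where
  open Graph G

  Vertex : Set
  Vertex = Fin n

  VSet : Set₁
  VSet = Vertex → Set

  _~_ : Vertex → Vertex → Set
  u ~ v = adj u v ≡ true

  -- G contains a (not necessarily induced) subgraph isomorphic to C₆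
  HasC6 : Set
  HasC6 = Σ (Fin 6 → Vertex) λ c → Injective _≡_ _≡_ c ×
            (c zero ~ c (suc zero)) ×
            (c (suc zero) ~ c (suc (suc zero))) ×
            (c (suc (suc zero)) ~ c (suc (suc (suc zero)))) ×
            (c (suc (suc (suc zero))) ~ c (suc (suc (suc (suc zero))))) ×
            (c (suc (suc (suc (suc zero)))) ~ c (suc (suc (suc (suc (suc zero)))))) ×
            (c (suc (suc (suc (suc (suc zero))))) ~ c zero)

  Nb : VSet → VSet
  Nb S v = ¬ S v × ∃ λ s → S s × s ~ v

  NbC : VSet → VSet
  NbC S v = S v ⊎ Nb S v

  N1 : Vertex → VSet
  N1 x v = x ~ v

  N2 : Vertex → VSet
  N2 x v = v ≢ x × ¬ (x ~ v) × ∃ λ w → x ~ w × w ~ v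

  N2C : Vertex → VSet
  N2C x v = v ≡ x ⊎ x ~ v ⊎ N2 x v

  data Reach (P : VSet) : Vertex → Vertex → Set where
    here : ∀ {u} → P u → Reach P u u
    step : ∀ {u w v} → P u → u ~ w → Reach P w v → Reach P u v

  -- the connected component of G[N₂(x)] containing u (u ∈ N₂(x))
  Comp : Vertex → Vertex → VSet
  Comp x u v = Reach (N2 x) u v

  -- the component of G[N₂(x)] represented by u belongs to A*
  InAstar : Vertex → Vertex → Set
  InAstar x u = ∃ λ a → Comp x u a ×
    (∀ w → (N1 x w × N1 a w) ⇔ (N1 x w × Nb (Comp x u) w))

  VAstar : Vertex → VSet
  VAstar x v = ∃ λ u → N2 x u × InAstar x u × Comp x u v

  VH : Vertex → VSet
  VH x v = N2C x v × ¬ NbC (VAstar x) v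

starAdj : ∀ {r} → Fin (suc r) → Fin (suc r) → Bool
starAdj zero    zero    = false
starAdj zero    (suc _) = true
starAdj (suc _) zero    = true
starAdj (suc _) (suc _) = false

IsoStar : ∀ {n} (G : Graph n) → (Fin n → Set) → ℕ → Set
IsoStar {n} G C r = Σ (Fin (suc r) → Fin n) λ f →
  Injective _≡_ _≡_ f ×
  (∀ v → C v ⇔ (∃ λ i → f i ≡ v)) ×
  (∀ i j → Graph.adj G (f i) (f j) ≡ starAdj i j)

module Submission where

-- Let u ∈ N₂(x) and let C be its component in G[N₂(x)].  Since C ⊆ V(H_x), u is
-- not in N[V(A*)], so C ∉ A*.

open import Defs
open import Data.Nat using (ℕ; _≤_)
open import Data.Fin using (Fin; zero; suc; _≟_)
open import Data.Fin.Properties using (any?)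
open import Data.Bool using (true)
import Data.Bool as Bool
open import Data.Bool.Properties using (¬-not)
open import Data.Product using (Σ; ∃; _×_; _,_; proj₂)
open import Data.Sum using (_⊎_; inj₁; inj₂)
open import Data.Empty using (⊥)
open import Data.List using (List; []; _∷_; length; filter; allFin; lookup)
open import Data.List.Membership.Propositional.Properties
  using (∈-filter⁺; ∈-filter⁻; ∈-allFin; ∈-lookup; ∈-length)
open import Data.List.Relation.Unary.All using ([]; _∷_)
import Data.List.Relation.Unary.All as All
open import Data.List.Relation.Unary.AllPairs using ([]; _∷_)
open import Data.List.Relation.Unary.Any using (index)
open import Data.List.Relation.Unary.Any.Properties using (lookup-index)
open import Data.List.Relation.Unary.Unique.Propositional using (Unique)
open import Data.List.Relation.Unary.Unique.Propositional.Properties using (filter⁺; allFin⁺)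
open import Function.Bundles using (_⇔_; mk⇔; Equivalence)
open import Relation.Nullary using (¬_; Dec; yes; no; contradiction)
open import Relation.Nullary.Decidable using (_×-dec_; ¬?; decidable-stable)
open import Relation.Unary using (Decidable)
open import Relation.Binary.PropositionalEquality
  using (_≡_; _≢_; refl; sym; trans; subst; cong; ≢-sym)

lookup-injective : ∀ {A : Set} {xs : List A} → Unique xs →
  ∀ {i j} → lookup xs i ≡ lookup xs j → i ≡ j
lookup-injective (_ ∷ _)    {zero}  {zero}  _ = refl
lookup-injective (x∉ ∷ _)   {zero}  {suc j} e = contradiction e (All.lookup x∉ (∈-lookup j))
lookup-injective (x∉ ∷ _)   {suc i} {zero}  e = contradiction (sym e) (All.lookup x∉ (∈-lookup i))
lookup-injective (_ ∷ uniq) {suc i} {suc j} e = cong suc (lookup-injective uniq e)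

module _ {n : ℕ} (G : Graph n) where
  open Graph G renaming (sym to adj-sym)

  infix 4 _∼_
  _∼_ : Fin n → Fin n → Set
  u ∼ v = _~_ G u v

  ∼-sym : ∀ {u v} → u ∼ v → v ∼ u
  ∼-sym {u} {v} uv = trans (adj-sym v u) uv

  ∼-irrefl : ∀ {v} → ¬ (v ∼ v)
  ∼-irrefl {v} vv with trans (sym vv) (irrefl v)
  ... | ()

  ∼⇒≢ : ∀ {u v} → u ∼ v → u ≢ v
  ∼⇒≢ uv refl = ∼-irrefl uv

  adj? : ∀ u v → Dec (u ∼ v)
  adj? u v = adj u v Bool.≟ true

  starIso : (C : Fin n → Set) (c : Fin n) {Leaf : Fin n → Set} (leaf? : Decidable Leaf) →
    (∀ {v} → Leaf v → c ∼ v) → (∀ {v w} → Leaf v → Leaf w → ¬ (v ∼ w)) →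
    (∀ v → C v ⇔ (v ≡ c ⊎ Leaf v)) →
    IsoStar G C (length (filter leaf? (allFin n)))
  starIso C c {Leaf} leaf? centre-adj leaves-apart C⇔ =
    lookup vs , lookup-injective distinct , covers , edges
    where
    leaves : List (Fin n)
    leaves = filter leaf? (allFin n)

    vs : List (Fin n)
    vs = c ∷ leaves

    isLeaf : ∀ i → Leaf (lookup leaves i)
    isLeaf i = proj₂ (∈-filter⁻ leaf? {xs = allFin n} (∈-lookup i))

    distinct : Unique vs
    distinct = All.tabulate (λ v∈ → ∼⇒≢ (centre-adj (proj₂ (∈-filter⁻ leaf? {xs = allFin n} v∈))))
             ∷ filter⁺ leaf? (allFin⁺ n)

    listed : ∀ {v} → v ≡ c ⊎ Leaf v → ∃ λ i → lookup vs i ≡ v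
    listed (inj₁ refl) = zero , refl
    listed {v} (inj₂ lv) = suc (index v∈) , sym (lookup-index v∈)
      where v∈ = ∈-filter⁺ leaf? (∈-allFin v) lv

    unlisted : ∀ {v} → (∃ λ i → lookup vs i ≡ v) → v ≡ c ⊎ Leaf v
    unlisted (zero , refl) = inj₁ refl
    unlisted (suc i , refl) = inj₂ (isLeaf i)

    covers : ∀ v → C v ⇔ (∃ λ i → lookup vs i ≡ v)
    covers v = mk⇔ (λ cv → listed (Equivalence.to (C⇔ v) cv))
                   (λ i → Equivalence.from (C⇔ v) (unlisted i))

    edges : ∀ i j → adj (lookup vs i) (lookup vs j) ≡ starAdj i j
    edges zero    zero    = irrefl c
    edges zero    (suc j) = centre-adj (isLeaf j)
    edges (suc i) zero    = ∼-sym (centre-adj (isLeaf i))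
    edges (suc i) (suc j) = ¬-not (leaves-apart (isLeaf i) (isLeaf j))

  hexagon : ∀ {a₀ a₁ a₂ a₃ a₄ a₅} → Unique (a₀ ∷ a₁ ∷ a₂ ∷ a₃ ∷ a₄ ∷ a₅ ∷ []) →
    a₀ ∼ a₁ → a₁ ∼ a₂ → a₂ ∼ a₃ → a₃ ∼ a₄ → a₄ ∼ a₅ → a₅ ∼ a₀ → HasC6 G
  hexagon {a₀} {a₁} {a₂} {a₃} {a₄} {a₅} distinct e₀₁ e₁₂ e₂₃ e₃₄ e₄₅ e₅₀ =
    lookup (a₀ ∷ a₁ ∷ a₂ ∷ a₃ ∷ a₄ ∷ a₅ ∷ []) , lookup-injective distinct ,
    e₀₁ , e₁₂ , e₂₃ , e₃₄ , e₄₅ , e₅₀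

  module _ (x : Fin n) where

    Attach : Fin n → Fin n → Set
    Attach a p = x ∼ p × p ∼ a

    attachment : ∀ {a} → N2 G x a → ∃ (Attach a)
    attachment (_ , _ , p , xp , pa) = p , xp , pa

    x≢N₂ : ∀ {a} → N2 G x a → x ≢ a
    x≢N₂ (a≢x , _) x≡a = a≢x (sym x≡a)

    N₁≢N₂ : ∀ {p a} → x ∼ p → N2 G x a → p ≢ a
    N₁≢N₂ xp (_ , ¬xa , _) refl = ¬xa xp

    N₂≢N₁ : ∀ {a p} → N2 G x a → x ∼ p → a ≢ p
    N₂≢N₁ na xp a≡p = N₁≢N₂ xp na (sym a≡p)

    n2? : ∀ v → Dec (N2 G x v)
    n2? v = ¬? (v ≟ x) ×-dec ¬? (adj? x v) ×-dec any? (λ w → adj? x w ×-dec adj? w v)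

    Walk : Fin n → Fin n → Set
    Walk = Reach G (N2 G x)

    origin : ∀ {a b} → Walk a b → N2 G x a
    origin (here na) = na
    origin (step na _ _) = na

    _▸_ : ∀ {a b c} → Walk a b → N2 G x c × b ∼ c → Walk a c
    here nb ▸ (nc , bc) = step nb bc (here nc)
    step na ab w ▸ e = step na ab (w ▸ e)

    reverse : ∀ {a b} → Walk a b → Walk b a
    reverse (here na) = here na
    reverse (step na ab w) = reverse w ▸ (na , ∼-sym ab)

    _++_ : ∀ {a b c} → Walk a b → Walk b c → Walk a c
    here _ ++ w' = w'
    step na ab w ++ w' = step na ab (w ++ w')

    StartsP₃ : Fin n → Set
    StartsP₃ s = Σ (Fin n) λ w → Σ (Fin n) λ t →
      N2 G x w × N2 G x t × s ∼ w × w ∼ t × t ≢ s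

    startsP₃? : ∀ s → Dec (StartsP₃ s)
    startsP₃? s = any? λ w → any? λ t →
      n2? w ×-dec n2? t ×-dec adj? s w ×-dec adj? w t ×-dec ¬? (t ≟ s)

    Centre : Fin n → Set
    Centre s = ∀ w → N2 G x w → s ∼ w → ∀ z → N2 G x z → w ∼ z → z ≡ s

    centre⇒¬P₃ : ∀ {s} → Centre s → ¬ StartsP₃ s
    centre⇒¬P₃ cen (w , t , nw , nt , sw , wt , t≢s) = t≢s (cen w nw sw t nt wt)

    ¬P₃⇒centre : ∀ {s} → ¬ StartsP₃ s → Centre s
    ¬P₃⇒centre {s} ¬P w nw sw z nz wz with z ≟ s
    ... | yes z≡s = z≡s
    ... | no z≢s = contradiction (w , z , nw , nz , sw , wz , z≢s) ¬P

    InStar : Fin n → Fin n → Set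
    InStar s t = t ≡ s ⊎ (N2 G x t × s ∼ t)

    star-closed : ∀ {s a t} → Centre s → InStar s a → Walk a t → InStar s t
    star-closed cen st (here _) = st
    star-closed cen (inj₁ refl) (step _ sb w) = star-closed cen (inj₂ (origin w , sb)) w
    star-closed cen (inj₂ (na , sa)) (step _ ab w) =
      star-closed cen (inj₁ (cen _ na sa _ (origin w) ab)) w

    inA* : ∀ {u} → N2 G x u →
      (∀ s w → Comp G x u s → s ∼ w → x ∼ w → u ∼ w) → InAstar G x u
    inA* {u} nu sees = u , here nu , λ w → mk⇔
      (λ (xw , uw) → xw , (λ cw → N₂≢N₁ (origin (reverse cw)) xw refl) , u , here nu , uw)
      (λ (xw , _ , s , cs , sw) → xw , sees s w cs sw xw)

    -- A centre of a component lies on every edge of it, so no edge of the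
    -- component joins two vertices that both start a P₃.
    centre-blocks : ∀ {c u v} → Centre c → Walk c u → N2 G x v → u ∼ v →
      StartsP₃ u → StartsP₃ v → ⊥
    centre-blocks cen cu nv uv Pu Pv with star-closed cen (inj₁ refl) cu
    ... | inj₁ refl = centre⇒¬P₃ cen Pu
    ... | inj₂ (nu , cu') = centre⇒¬P₃ cen (subst StartsP₃ (cen _ nu cu' _ nv uv) Pv)

    -- Either u or the second vertex of a P₃ from u is a centre, or no vertex of
    -- the component of u is one.
    centre-or-allP₃ : ∀ {u} → N2 G x u →
      (∃ λ c → Walk u c × Centre c) ⊎ (∀ t → Walk u t → StartsP₃ t)
    centre-or-allP₃ {u} nu with startsP₃? u
    ... | no ¬Pu = inj₁ (u , here nu , ¬P₃⇒centre ¬Pu)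
    ... | yes Pu@(v , _ , nv , _ , uv , _) with startsP₃? v
    ...   | no ¬Pv = inj₁ (v , here nu ▸ (nv , uv) , ¬P₃⇒centre ¬Pv)
    ...   | yes Pv = inj₂ λ t ut → decidable-stable (startsP₃? t)
              λ ¬Pt → centre-blocks (¬P₃⇒centre ¬Pt) (reverse ut) nv uv Pu Pv

    star-component : ∀ {u c} → N2 G x u → ¬ InAstar G x u → Walk u c → Centre c →
      ∃ λ r → 1 ≤ r × IsoStar G (Comp G x u) r
    star-component {u} {c} nu ¬A* uc cen =
      _ , has-leaf , starIso (Comp G x u) c leaf? proj₂ apart members
      where
      Leaf : Fin n → Set
      Leaf v = N2 G x v × c ∼ v

      leaf? : Decidable Leaf
      leaf? v = n2? v ×-dec adj? c v

      apart : ∀ {v w} → Leaf v → Leaf w → ¬ (v ∼ w)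
      apart (nv , cv) (nw , cw) vw = ∼-irrefl (subst (c ∼_) (cen _ nv cv _ nw vw) cw)

      members : ∀ v → Comp G x u v ⇔ (v ≡ c ⊎ Leaf v)
      members v = mk⇔ (λ uv → star-closed cen (inj₁ refl) (reverse uc ++ uv))
                      λ { (inj₁ refl) → uc ; (inj₂ lv) → uc ▸ lv }

      -- without leaves the component is {c} = {u}, which lies in A*
      has-leaf : 1 ≤ length (filter leaf? (allFin n))
      has-leaf with any? leaf?
      ... | yes (v , lv) = ∈-length (∈-filter⁺ leaf? (∈-allFin v) lv)
      ... | no no-leaf = contradiction (inA* nu sees) ¬A*
        where
        only-c : ∀ {s} → Walk u s → s ≡ c
        only-c us with Equivalence.to (members _) us
        ... | inj₁ s≡c = s≡c
        ... | inj₂ ls = contradiction (_ , ls) no-leaf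

        sees : ∀ s w → Comp G x u s → s ∼ w → x ∼ w → u ∼ w
        sees s w us sw _ = subst (_∼ w) (trans (only-c us) (sym (only-c (here nu)))) sw

    module _ (noC6 : ¬ HasC6 G) where

      -- The ends of a path a–b–c in G[N₂(x)] have the same attachments:
      -- distinct ones p, q would close the hexagon x p a b c q.
      ends-share : ∀ {a b c p q} → N2 G x a → N2 G x b → N2 G x c →
        a ∼ b → b ∼ c → a ≢ c → Attach a p → Attach c q → p ≡ q
      ends-share {p = p} {q} na nb nc ab bc a≢c (xp , pa) (xq , qc) with p ≟ q
      ... | yes p≡q = p≡q
      ... | no p≢q = contradiction
        (hexagon
          ((∼⇒≢ xp ∷ x≢N₂ na ∷ x≢N₂ nb ∷ x≢N₂ nc ∷ ∼⇒≢ xq ∷ []) ∷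
           (N₁≢N₂ xp na ∷ N₁≢N₂ xp nb ∷ N₁≢N₂ xp nc ∷ p≢q ∷ []) ∷
           (∼⇒≢ ab ∷ a≢c ∷ N₂≢N₁ na xq ∷ []) ∷
           (∼⇒≢ bc ∷ N₂≢N₁ nb xq ∷ []) ∷
           (N₂≢N₁ nc xq ∷ []) ∷ [] ∷ [])
          xp pa ab bc (∼-sym qc) (∼-sym xq))
        noC6

      passes-along : ∀ {a b c p} → N2 G x a → N2 G x b → N2 G x c →
        a ∼ b → b ∼ c → a ≢ c → Attach a p → Attach c p
      passes-along na nb nc ab bc a≢c Ap with attachment nc
      ... | q , Aq = subst (Attach _) (sym (ends-share na nb nc ab bc a≢c Ap Aq)) Aq

      -- Two disjoint edges a–b, c–d of G[N₂(x)] attached crosswise (p to a and d,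
      -- q to b and c) force p = q: otherwise p a b q c d is a hexagon.
      crossed : ∀ {a b c d p q} → N2 G x a → N2 G x b → N2 G x c → N2 G x d →
        a ≢ c → a ≢ d → b ≢ c → b ≢ d → a ∼ b → c ∼ d →
        Attach a p → Attach d p → Attach b q → Attach c q → p ≡ q
      crossed {p = p} {q} na nb nc nd a≢c a≢d b≢c b≢d ab cd (xp , pa) (_ , pd) (xq , qb) (_ , qc)
        with p ≟ q
      ... | yes p≡q = p≡q
      ... | no p≢q = contradiction
        (hexagon
          ((N₁≢N₂ xp na ∷ N₁≢N₂ xp nb ∷ p≢q ∷ N₁≢N₂ xp nc ∷ N₁≢N₂ xp nd ∷ []) ∷
           (∼⇒≢ ab ∷ N₂≢N₁ na xq ∷ a≢c ∷ a≢d ∷ []) ∷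
           (N₂≢N₁ nb xq ∷ b≢c ∷ b≢d ∷ []) ∷
           (N₁≢N₂ xq nc ∷ N₁≢N₂ xq nd ∷ []) ∷
           (∼⇒≢ cd ∷ []) ∷ [] ∷ [])
          pa ab (∼-sym qb) qc cd (∼-sym pd))
        noC6

      detour : ∀ {u v w t p q} → N2 G x u → N2 G x v → N2 G x w → N2 G x t →
        u ∼ v → u ∼ w → w ∼ t → w ≢ v → t ≢ u → Attach u p → Attach v q → p ≡ q
      detour {v = v} {t = t} nu nv nw nt uv uw wt w≢v t≢u Ap Aq with t ≟ v
      ... | yes refl = ends-share nu nt nw uv (∼-sym wt) (∼⇒≢ uw) Ap
                         (passes-along nv nu nw (∼-sym uv) uw (≢-sym w≢v) Aq)
      ... | no t≢v = crossed nt nw nv nu t≢v t≢u w≢v (≢-sym (∼⇒≢ uw)) (∼-sym wt) (∼-sym uv)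
                       (passes-along nu nw nt uw wt (≢-sym t≢u) Ap) Ap
                       (passes-along nv nu nw (∼-sym uv) uw (≢-sym w≢v) Aq) Aq

      back-to-back : ∀ {u v t t' p q} → N2 G x u → N2 G x v → N2 G x t → N2 G x t' →
        u ∼ v → v ∼ t → u ∼ t' → t ≢ u → t' ≢ v → Attach u p → Attach v q → p ≡ q
      back-to-back {t = t} {t'} nu nv nt nt' uv vt ut' t≢u t'≢v Ap Aq with t ≟ t'
      ... | yes refl = ends-share nu nv nt uv vt (≢-sym t≢u) Ap
                         (passes-along nv nu nt (∼-sym uv) ut' (∼⇒≢ vt) Aq)
      ... | no t≢t' = crossed nt nv nt' nu t≢t' t≢u (≢-sym t'≢v) (≢-sym (∼⇒≢ uv))
                        (∼-sym vt) (∼-sym ut')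
                        (passes-along nu nv nt uv vt (≢-sym t≢u) Ap) Ap
                        Aq (passes-along nv nu nt' (∼-sym uv) ut' (≢-sym t'≢v) Aq)

      edge-shares : ∀ {u v p q} → N2 G x u → N2 G x v → u ∼ v →
        StartsP₃ u → StartsP₃ v → Attach u p → Attach v q → p ≡ q
      edge-shares {u} {v} nu nv uv (w , t , nw , nt , uw , wt , t≢u)
                              (w' , t' , nw' , nt' , vw' , w't' , t'≢v) Ap Aq
        with w ≟ v | w' ≟ u
      ... | no w≢v  | _         = detour nu nv nw nt uv uw wt w≢v t≢u Ap Aq
      ... | yes refl | no w'≢u  = sym (detour nv nu nw' nt' (∼-sym uv) vw' w't' w'≢u t'≢v Aq Ap)
      ... | yes refl | yes refl = back-to-back nu nv nt nt' uv wt w't' t≢u t'≢v Ap Aq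

      -- a vertex starting a P₃ a–w–t has a single attachment, namely that of t
      unique-attachment : ∀ {a p q} → N2 G x a → StartsP₃ a → Attach a p → Attach a q → p ≡ q
      unique-attachment na (w , t , nw , nt , aw , wt , t≢a) Ap Aq =
        ends-share na nw nt aw wt (≢-sym t≢a) Ap (passes-along na nw nt aw wt (≢-sym t≢a) Aq)

      component-shares : ∀ {u s p q} → (∀ t → Walk u t → StartsP₃ t) →
        Walk u s → Attach u p → Attach s q → p ≡ q
      component-shares allP (here nu) Ap Aq = unique-attachment nu (allP _ (here nu)) Ap Aq
      component-shares allP (step nu uw ws) Ap Aq with attachment (origin ws)
      ... | r , Ar = trans
        (edge-shares nu (origin ws) uw (allP _ (here nu)) (allP _ (here nu ▸ (origin ws , uw)))
                     Ap Ar)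
        (component-shares (λ t wt → allP t (step nu uw wt)) ws Ar Aq)

      allP₃⇒inA* : ∀ {u} → N2 G x u → (∀ t → Walk u t → StartsP₃ t) → InAstar G x u
      allP₃⇒inA* {u} nu allP with attachment nu
      ... | p , Ap@(_ , pu) = inA* nu λ s w us sw xw →
        ∼-sym (subst (_∼ u) (component-shares allP us Ap (xw , ∼-sym sw)) pu)

H-component-not-in-A* : ∀ {n} (G : Graph n) x u → N2 G x u →
  (∀ v → Comp G x u v → VH G x v) → ¬ InAstar G x u
H-component-not-in-A* G x u nu inH u∈A* =
  proj₂ (inH u (here nu)) (inj₁ (u , nu , u∈A* , here nu))

corollary2 : ∀ {n} (G : Graph n) → ¬ HasC6 G → ∀ x u → N2 G x u →
    (∀ v → Comp G x u v → VH G x v) →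
    ∃ λ r → 1 ≤ r × IsoStar G (Comp G x u) r
corollary2 G noC6 x u nu inH
  with H-component-not-in-A* G x u nu inH | centre-or-allP₃ G x nu
... | ¬A* | inj₁ (c , uc , cen) = star-component G x nu ¬A* uc cen
... | ¬A* | inj₂ allP = contradiction (allP₃⇒inA* G x noC6 nu allP) ¬A*
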